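{- Let $\mathfrak{g}=\mathfrak{so}_5(\mathbb{C})$ (type $B_2$). Let $\lambda=c_1\varpi_1+c_2\varpi_2$ with $c_1,c_2\in\mathbb{Z}$ and $2\mid c_2$, and let $\mu=n\varpi_1+m\varpi_2$ with $n,m\in\mathbb{N}$ and $2\mid m$. Consider the inequalities $J_1:\ \tfrac{c_2-m}{2}+c_1-n\ge 0$; $J_2:\ c_1+c_2-n-m\ge 0$; $J_3:\ \tfrac{c_2-m}{2}-n-1\ge 0$; $J_4:\ c_1-n-m-1\ge 0$; $J_5:\ -c_1-n-m-3\ge 0$; $J_6:\ \tfrac{ -c_2-m}{2}-n-2\ge 0$; $J_7:\ \tfrac{ -c_2-m}{2}-c_1-n-3\ge 0$; $J_8:\ -c_1-c_2-n-m-4\ge 0$, and write $\neg J_i$ for the failure of $J_i$. Then $\mathcal{A}(\lambda,\mu)$ equals: $\{1\}$ if $J_1,J_2,\neg J_3,\neg J_4$; $\{s_1\}$ if $J_2,J_3,\neg J_1,\neg J_5$; $\{s_2\}$ if $J_1,J_4,\neg J_2,\neg J_6$; $\{s_2s_1\}$ if $J_3,J_5,\neg J_2,\neg J_7$; $\{s_1s_2\}$ if $J_6,J_4,\neg J_8,\neg J_1$; $\{s_1s_2s_1\}$ if $J_7,J_5,\neg J_8,\neg J_3$; $\{s_2s_1s_2\}$ if $J_6,J_8,\neg J_4,\neg J_7$; $\{(s_2s_1)^2\}$ if $J_7,J_8,\neg J_5,\neg J_6$; $\{1,s_1\}$ if $J_1,J_3,\neg J_4,\neg J_5$; $\{1,s_2\}$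 if $J_2,J_4,\neg J_3,\neg J_6$; $\{s_1,s_2s_1\}$ if $J_2,J_5,\neg J_1,\neg J_7$; $\{s_2,s_1s_2\}$ if $J_1,J_6,\neg J_2,\neg J_8$; $\{s_2s_1,s_1s_2s_1\}$ if $J_3,J_7,\neg J_2,\neg J_8$; $\{s_1s_2,s_2s_1s_2\}$ if $J_4,J_8,\neg J_1,\neg J_7$; $\{s_1s_2s_1,(s_2s_1)^2\}$ if $J_5,J_8,\neg J_6,\neg J_3$; $\{s_2s_1s_2,(s_2s_1)^2\}$ if $J_6,J_7,\neg J_5,\neg J_4$; $\{1,s_1,s_2\}$ if $J_3,J_4,\neg J_5,\neg J_6$; $\{1,s_1,s_2s_1\}$ if $J_1,J_5,\neg J_4,\neg J_7$; $\{1,s_2,s_1s_2\}$ if $J_2,J_6,\neg J_3,\neg J_8$; $\{s_1,s_2s_1,s_1s_2s_1\}$ if $J_7,J_2,\neg J_8,\neg J_1$; $\{s_2,s_1s_2,s_2s_1s_2\}$ if $J_1,J_8,\neg J_2,\neg J_7$; $\{s_2s_1,s_1s_2s_1,(s_2s_1)^2\}$ if $J_3,J_8,\neg J_2,\neg J_6$; $\{s_1s_2,s_2s_1s_2,(s_2s_1)^2\}$ if $J_7,J_4,\neg J_5,\neg J_1$; $\{s_1s_2s_1,s_2s_1s_2,(s_2s_1)^2\}$ if $J_6,J_5,\neg J_4,\neg J_3$; and $\emptyset$ otherwise.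
   Context: $\mathfrak{so}_5(\mathbb{C})$ has simple roots $\alpha_1$ (long), $\alpha_2$ (short), positive roots $\Phi^+=\{\alpha_1,\alpha_2,\alpha_1+\alpha_2,\alpha_1+2\alpha_2\}$, fundamental weights $\varpi_1=\alpha_1+\alpha_2$, $\varpi_2=\tfrac12\alpha_1+\alpha_2$, and $\rho=\varpi_1+\varpi_2=\tfrac32\alpha_1+2\alpha_2$. The Weyl group $W$ (dihedral of order 8) is generated by the simple reflections $s_1,s_2$, acting linearly with $s_i(\alpha_i)=-\alpha_i$, $s_1(\alpha_2)=\alpha_2+\alpha_1$, $s_2(\alpha_1)=\alpha_1+2\alpha_2$, and $s_i(\varpi_j)=\varpi_j-\delta_{ij}\alpha_j$. $\mathbb{N}=\{0,1,2,\dots\}$. Kostant's partition function $\wp(\xi)$ is the number of ways to write $\xi$ as a nonnegative integral linear combination of positive roots. The Weyl alternation set is $\mathcal{A}(\lambda,\mu)=\{\sigma\in W:\ \wp(\sigma(\lambda+\rho)-(\mu+\rho))>0\}$. -}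

module Defs where

open import Data.Nat using (ℕ)
open import Data.Integer using (ℤ; +_; -_; _+_; _-_; _*_; ∣_∣; _≟_; _≤_)
open import Data.Product using (_×_; _,_)
open import Data.List using (List; []; _∷_; upTo; concatMap; filter; length; foldr)
open import Data.Product.Properties using (≡-dec)
open import Relation.Nullary using (Dec; ¬_)
open import Relation.Binary.PropositionalEquality using (_≡_)

-- Weights of so₅(ℂ) (type B₂), written in the basis of fundamental
-- weights:  (a , b)  stands for  a ϖ₁ + b ϖ₂.
-- With ϖ₁ = α₁ + α₂, ϖ₂ = ½α₁ + α₂ we get
--   α₁ = 2ϖ₁ - 2ϖ₂ ,  α₂ = -ϖ₁ + 2ϖ₂ ,
--   α₁ + α₂ = ϖ₁ ,    α₁ + 2α₂ = 2ϖ₂ ,  ρ = ϖ₁ + ϖ₂.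

Weight : Set
Weight = ℤ × ℤ

_⊕_ : Weight → Weight → Weight
(a , b) ⊕ (c , d) = (a + c , b + d)

_⊖_ : Weight → Weight → Weight
(a , b) ⊖ (c , d) = (a - c , b - d)

_·_ : ℤ → Weight → Weight
k · (a , b) = (k * a , k * b)

α₁ α₂ ρ : Weight
α₁ = (+ 2 , - (+ 2))
α₂ = (- (+ 1) , + 2)
ρ  = (+ 1 , + 1)

wt : ℤ → ℤ → Weight
wt c₁ c₂ = (c₁ , c₂)

-- Kostant's partition function.
-- ℘ ξ = number of (k₁,k₂,k₃,k₄) ∈ ℕ⁴ with
--   ξ = k₁ α₁ + k₂ α₂ + k₃ (α₁+α₂) + k₄ (α₁+2α₂).
-- Any such k has every kᵢ ≤ |a| + |b| where ξ = (a , b) (in α-coordinates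
-- ξ = (a + b/2) α₁ + (a + b) α₂ and kᵢ is bounded by one of these), so
-- counting over the box [0 , |a|+|b|]⁴ counts all of them.

combo : ℕ → ℕ → ℕ → ℕ → Weight
combo k₁ k₂ k₃ k₄ =
  ((+ k₁) · α₁) ⊕ (((+ k₂) · α₂) ⊕ (((+ k₃) · (α₁ ⊕ α₂)) ⊕ ((+ k₄) · (α₁ ⊕ (α₂ ⊕ α₂)))))

_≟w_ : (v w : Weight) → Dec (v ≡ w)
_≟w_ = ≡-dec _≟_ _≟_

Quad : Set
Quad = ℕ × ℕ × ℕ × ℕ

box : ℕ → List Quad
box B = concatMap (λ k₁ → concatMap (λ k₂ → concatMap (λ k₃ → concatMap
          (λ k₄ → (k₁ , k₂ , k₃ , k₄) ∷ []) r) r) r) r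
  where r = upTo (Data.Nat.suc B)

℘ : Weight → ℕ
℘ (a , b) = length (filter (λ { (k₁ , k₂ , k₃ , k₄) → combo k₁ k₂ k₃ k₄ ≟w (a , b) })
                           (box (∣ a ∣ Data.Nat.+ ∣ b ∣)))

data W : Set where
  e s₁ s₂ s₂s₁ s₁s₂ s₁s₂s₁ s₂s₁s₂ s₂s₁s₂s₁ : W

-- simple reflections: s₁(a,b) = (a,b) - a α₁ , s₂(a,b) = (a,b) - b α₂
refl₁ refl₂ : Weight → Weight
refl₁ (a , b) = (- a , b + (+ 2) * a)
refl₂ (a , b) = (a + b , - b)

-- action of a word: the rightmost letter acts first
act : W → Weight → Weight
act e v = v
act s₁ v = refl₁ v
act s₂ v = refl₂ v
act s₂s₁ v = refl₂ (refl₁ v)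
act s₁s₂ v = refl₁ (refl₂ v)
act s₁s₂s₁ v = refl₁ (refl₂ (refl₁ v))
act s₂s₁s₂ v = refl₂ (refl₁ (refl₂ v))
act s₂s₁s₂s₁ v = refl₂ (refl₁ (refl₂ (refl₁ v)))

InA : Weight → Weight → W → Set
InA λ' μ σ = 0 Data.Nat.< ℘ ((act σ (λ' ⊕ ρ)) ⊖ (μ ⊕ ρ))

-- The inequalities J₁ … J₈, each multiplied by 2 to clear the halves
-- (an equivalent condition over ℤ).  Arguments: c₁ c₂ n m.

data Idx : Set where
  j1 j2 j3 j4 j5 j6 j7 j8 : Idx

twoJ : Idx → ℤ → ℤ → ℤ → ℤ → ℤ
twoJ j1 c₁ c₂ n m = (c₂ - m) + (+ 2) * (c₁ - n)
twoJ j2 c₁ c₂ n m = (+ 2) * (c₁ + c₂ - n - m)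
twoJ j3 c₁ c₂ n m = (c₂ - m) - (+ 2) * (n + + 1)
twoJ j4 c₁ c₂ n m = (+ 2) * (c₁ - n - m - + 1)
twoJ j5 c₁ c₂ n m = (+ 2) * (- c₁ - n - m - + 3)
twoJ j6 c₁ c₂ n m = (- c₂ - m) - (+ 2) * (n + + 2)
twoJ j7 c₁ c₂ n m = (- c₂ - m) - (+ 2) * (c₁ + n + + 3)
twoJ j8 c₁ c₂ n m = (+ 2) * (- c₁ - c₂ - n - m - + 4)

J : Idx → ℤ → ℤ → ℤ → ℤ → Set
J i c₁ c₂ n m = + 0 ≤ twoJ i c₁ c₂ n m

record Case : Set where
  constructor case
  field
    pos₁ pos₂ neg₁ neg₂ : Idx
    set : List W

Holds : Case → ℤ → ℤ → ℤ → ℤ → Set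
Holds (case p q r s _) c₁ c₂ n m =
  J p c₁ c₂ n m × J q c₁ c₂ n m × ¬ J r c₁ c₂ n m × ¬ J s c₁ c₂ n m

cases : List Case
cases =
    case j1 j2 j3 j4 (e ∷ [])
  ∷ case j2 j3 j1 j5 (s₁ ∷ [])
  ∷ case j1 j4 j2 j6 (s₂ ∷ [])
  ∷ case j3 j5 j2 j7 (s₂s₁ ∷ [])
  ∷ case j6 j4 j8 j1 (s₁s₂ ∷ [])
  ∷ case j7 j5 j8 j3 (s₁s₂s₁ ∷ [])
  ∷ case j6 j8 j4 j7 (s₂s₁s₂ ∷ [])
  ∷ case j7 j8 j5 j6 (s₂s₁s₂s₁ ∷ [])
  ∷ case j1 j3 j4 j5 (e ∷ s₁ ∷ [])
  ∷ case j2 j4 j3 j6 (e ∷ s₂ ∷ [])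
  ∷ case j2 j5 j1 j7 (s₁ ∷ s₂s₁ ∷ [])
  ∷ case j1 j6 j2 j8 (s₂ ∷ s₁s₂ ∷ [])
  ∷ case j3 j7 j2 j8 (s₂s₁ ∷ s₁s₂s₁ ∷ [])
  ∷ case j4 j8 j1 j7 (s₁s₂ ∷ s₂s₁s₂ ∷ [])
  ∷ case j5 j8 j6 j3 (s₁s₂s₁ ∷ s₂s₁s₂s₁ ∷ [])
  ∷ case j6 j7 j5 j4 (s₂s₁s₂ ∷ s₂s₁s₂s₁ ∷ [])
  ∷ case j3 j4 j5 j6 (e ∷ s₁ ∷ s₂ ∷ [])
  ∷ case j1 j5 j4 j7 (e ∷ s₁ ∷ s₂s₁ ∷ [])
  ∷ case j2 j6 j3 j8 (e ∷ s₂ ∷ s₁s₂ ∷ [])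
  ∷ case j7 j2 j8 j1 (s₁ ∷ s₂s₁ ∷ s₁s₂s₁ ∷ [])
  ∷ case j1 j8 j2 j7 (s₂ ∷ s₁s₂ ∷ s₂s₁s₂ ∷ [])
  ∷ case j3 j8 j2 j6 (s₂s₁ ∷ s₁s₂s₁ ∷ s₂s₁s₂s₁ ∷ [])
  ∷ case j7 j4 j5 j1 (s₁s₂ ∷ s₂s₁s₂ ∷ s₂s₁s₂s₁ ∷ [])
  ∷ case j6 j5 j4 j3 (s₁s₂s₁ ∷ s₂s₁s₂ ∷ s₂s₁s₂s₁ ∷ [])
  ∷ []

-- Write ξσ = σ(λ+ρ) − (μ+ρ). As W acts trivially on weights modulo the root lattice and λ − μ
-- lies in it, so does ξσ; then ℘(ξσ) > 0 exactly when both simple-root coordinates of ξσ are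
-- nonnegative (ξσ itself, written in α₁ and α₂, is the witness). These two coordinates are the
-- left-hand sides of two of the inequalities J₁, …, J₈, so σ ∈ 𝒜(λ, μ) iff both of them hold.
-- Around the circle J₁, J₂, J₃, J₅, J₇, J₈, J₆, J₄ the eight pairs arising this way are the pairs
-- of neighbours, and linear identities with slack coming from n, m ≥ 0 (e.g. J₂ = J₁ + J₃ + n + 1)
-- force the inequalities that hold to form an arc of at most four consecutive ones. Checking all
-- 2⁸ truth patterns obeying these rules against the table finishes the proof.
module Submission where

open import Defs
open import Data.Bool using (Bool; true; false; not; _∧_; _∨_; T)
open import Data.Bool.ListAction using (all; any)
open import Data.Bool.Properties using (T-∧; T-∨)
open import Data.Empty using (⊥; ⊥-elim)
open import Data.Fin using (Fin; zero; suc)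
import Data.Fin.Properties as Fin
open import Data.Integer as ℤ using (ℤ; +_; -[1+_]; -_; _+_; _-_; _*_; ∣_∣; +≤+; _≤_; 0ℤ)
import Data.Integer.Divisibility as ℤ
import Data.Integer.Properties as ℤ
open import Data.Integer.Divisibility.Signed using (_∣_; divides; ∣ᵤ⇒∣; ∣m∣n⇒∣m+n; ∣m∣n⇒∣m-n)
open import Data.Integer.Solver using (module +-*-Solver)
open import Data.Integer.Tactic.RingSolver using (solve-∀)
open import Data.List using (List; []; _∷_; length; filter; filterᵇ; upTo; concatMap; lookup)
open import Data.List.Membership.Propositional using (_∈_; lose; find)
open import Data.List.Membership.Propositional.Properties
  using (∈-filter⁺; ∈-filter⁻; ∈-length; ∈-concatMap⁺; ∈-upTo⁺; ∈-lookup)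
open import Data.List.Properties using (≡-dec)
open import Data.List.Relation.Unary.All as All using (All; []; _∷_)
open import Data.List.Relation.Unary.All.Properties using (all⁺; all⁻)
open import Data.List.Relation.Unary.Any using (here)
open import Data.List.Relation.Unary.Any.Properties using (any⁻; ¬Any[])
open import Data.Nat as ℕ using (ℕ; z≤n; s≤s)
import Data.Nat.Properties as ℕ
open import Data.Product using (_×_; _,_; proj₁; proj₂; ∃)
open import Data.Product.Function.NonDependent.Propositional using (_×-⇔_)
open import Data.Product.Properties using (×-≡,≡→≡)
open import Data.Sum using (inj₁; inj₂)
open import Data.Vec using (Vec; []; _∷_)
import Data.Vec as Vec
open import Function.Base using (_∘_)
open import Function.Bundles using (_⇔_; mk⇔; Equivalence)
import Function.Properties.Equivalence as ⇔
open import Relation.Binary.Definitions using (DecidableEquality)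
open import Relation.Binary.PropositionalEquality using (_≡_; refl; sym; trans; cong; cong₂; subst)
open import Relation.Nullary using (¬_; Dec)
open import Relation.Nullary.Decidable
  using (map′; isYes; ⌊_⌋; T?; toWitness; fromWitness; toWitnessFalse; fromWitnessFalse)
open import Relation.Unary using (Decidable)

open +-*-Solver using (Polynomial; con; var; _:+_; _:*_; :-_; _:-_; _:=_; solve)

0≤2*i⇒0≤i : ∀ {i} → 0ℤ ≤ + 2 * i → 0ℤ ≤ i
0≤2*i⇒0≤i {+ _} _ = +≤+ z≤n
0≤2*i⇒0≤i { -[1+ _ ]} ()

0≤i⇒0≤2*i : ∀ {i} → 0ℤ ≤ i → 0ℤ ≤ + 2 * i
0≤i⇒0≤2*i = ℤ.*-monoˡ-≤-nonNeg (+ 2)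

0≤-sum : ∀ {x y z w} → z ≡ x + y + + w → 0ℤ ≤ x → 0ℤ ≤ y → 0ℤ ≤ z
0≤-sum refl 0≤x 0≤y = ℤ.+-mono-≤ (ℤ.+-mono-≤ 0≤x 0≤y) (+≤+ z≤n)

negative-sum-excludes : ∀ {x y w k} → x + y + + w ≡ -[1+ k ] → 0ℤ ≤ x → 0ℤ ≤ y → ⊥
negative-sum-excludes eq 0≤x 0≤y with () ← 0≤-sum (sym eq) 0≤x 0≤y

-- Copies of definitions as ring-solver syntax: ⟦_⟧ of a copy unfolds to the original, so an
-- identity stated with the originals is proved by `solve … refl` on the copies.
Weightᴾ : ℕ → Set
Weightᴾ k = Polynomial k × Polynomial k

_⊕ᴾ_ _⊖ᴾ_ : ∀ {k} → Weightᴾ k → Weightᴾ k → Weightᴾ k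
(a , b) ⊕ᴾ (c , d) = (a :+ c , b :+ d)
(a , b) ⊖ᴾ (c , d) = (a :- c , b :- d)

_·ᴾ_ : ∀ {k} → Polynomial k → Weightᴾ k → Weightᴾ k
x ·ᴾ (a , b) = (x :* a , x :* b)

α₁ᴾ α₂ᴾ ρᴾ : ∀ {k} → Weightᴾ k
α₁ᴾ = (con (+ 2) , con (- (+ 2)))
α₂ᴾ = (con (- (+ 1)) , con (+ 2))
ρᴾ = (con (+ 1) , con (+ 1))

refl₁ᴾ refl₂ᴾ : ∀ {k} → Weightᴾ k → Weightᴾ k
refl₁ᴾ (a , b) = (:- a , b :+ con (+ 2) :* a)
refl₂ᴾ (a , b) = (a :+ b , :- b)

actᴾ : ∀ {k} → W → Weightᴾ k → Weightᴾ k
actᴾ e v = v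
actᴾ s₁ v = refl₁ᴾ v
actᴾ s₂ v = refl₂ᴾ v
actᴾ s₂s₁ v = refl₂ᴾ (refl₁ᴾ v)
actᴾ s₁s₂ v = refl₁ᴾ (refl₂ᴾ v)
actᴾ s₁s₂s₁ v = refl₁ᴾ (refl₂ᴾ (refl₁ᴾ v))
actᴾ s₂s₁s₂ v = refl₂ᴾ (refl₁ᴾ (refl₂ᴾ v))
actᴾ s₂s₁s₂s₁ v = refl₂ᴾ (refl₁ᴾ (refl₂ᴾ (refl₁ᴾ v)))

twoJᴾ : ∀ {k} → Idx → Polynomial k → Polynomial k → Polynomial k → Polynomial k → Polynomial k
twoJᴾ j1 c₁ c₂ n m = (c₂ :- m) :+ con (+ 2) :* (c₁ :- n)
twoJᴾ j2 c₁ c₂ n m = con (+ 2) :* (c₁ :+ c₂ :- n :- m)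
twoJᴾ j3 c₁ c₂ n m = (c₂ :- m) :- con (+ 2) :* (n :+ con (+ 1))
twoJᴾ j4 c₁ c₂ n m = con (+ 2) :* (c₁ :- n :- m :- con (+ 1))
twoJᴾ j5 c₁ c₂ n m = con (+ 2) :* (:- c₁ :- n :- m :- con (+ 3))
twoJᴾ j6 c₁ c₂ n m = (:- c₂ :- m) :- con (+ 2) :* (n :+ con (+ 2))
twoJᴾ j7 c₁ c₂ n m = (:- c₂ :- m) :- con (+ 2) :* (c₁ :+ n :+ con (+ 3))
twoJᴾ j8 c₁ c₂ n m = con (+ 2) :* (:- c₁ :- c₂ :- n :- m :- con (+ 4))

-- Weights modulo the root lattice

-- v ∼ w: v − w lies in the root lattice ℤα₁ + ℤα₂, i.e. its ϖ₂-coordinate is even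
record _∼_ (v w : Weight) : Set where
  constructor evenDifference
  field even : + 2 ∣ proj₂ v - proj₂ w

∼-refl : ∀ v → v ∼ v
∼-refl (_ , b) = evenDifference (divides 0ℤ (ℤ.+-inverseʳ b))

∼-trans : ∀ {u v w} → u ∼ v → v ∼ w → u ∼ w
∼-trans {_ , b} {_ , d} {_ , f} (evenDifference u∼v) (evenDifference v∼w) =
  evenDifference (subst (+ 2 ∣_) (telescope b d f) (∣m∣n⇒∣m+n u∼v v∼w))
  where
  telescope : ∀ b d f → (b - d) + (d - f) ≡ b - f
  telescope = solve-∀

refl₁-∼ : ∀ v → refl₁ v ∼ v
refl₁-∼ (a , b) = evenDifference (divides a (shift a b))
  where
  shift : ∀ a b → (b + + 2 * a) - b ≡ a * + 2
  shift = solve-∀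

refl₂-∼ : ∀ v → refl₂ v ∼ v
refl₂-∼ (_ , b) = evenDifference (divides (- b) (shift b))
  where
  shift : ∀ b → - b - b ≡ - b * + 2
  shift = solve-∀

refl₁-∼ˡ : ∀ {w v} → w ∼ v → refl₁ w ∼ v
refl₁-∼ˡ = ∼-trans (refl₁-∼ _)

refl₂-∼ˡ : ∀ {w v} → w ∼ v → refl₂ w ∼ v
refl₂-∼ˡ = ∼-trans (refl₂-∼ _)

act-∼ : ∀ σ v → act σ v ∼ v
act-∼ e v = ∼-refl v
act-∼ s₁ v = refl₁-∼ v
act-∼ s₂ v = refl₂-∼ v
act-∼ s₂s₁ v = refl₂-∼ˡ (refl₁-∼ v)
act-∼ s₁s₂ v = refl₁-∼ˡ (refl₂-∼ v)
act-∼ s₁s₂s₁ v = refl₁-∼ˡ (refl₂-∼ˡ (refl₁-∼ v))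
act-∼ s₂s₁s₂ v = refl₂-∼ˡ (refl₁-∼ˡ (refl₂-∼ v))
act-∼ s₂s₁s₂s₁ v = refl₂-∼ˡ (refl₁-∼ˡ (refl₂-∼ˡ (refl₁-∼ v)))

⊕ρ-∼ : ∀ {v w} → v ∼ w → (v ⊕ ρ) ∼ (w ⊕ ρ)
⊕ρ-∼ {_ , b} {_ , d} (evenDifference v∼w) =
  evenDifference (subst (+ 2 ∣_) (sym (cancel b d)) v∼w)
  where
  cancel : ∀ b d → (b + + 1) - (d + + 1) ≡ b - d
  cancel = solve-∀

-- Kostant's partition function on the root lattice

-- aϖ₁ + bϖ₂ = ½(2a + b) α₁ + ½(2a + 2b) α₂
twiceCoord₁ twiceCoord₂ : Weight → ℤ
twiceCoord₁ (a , b) = + 2 * a + b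
twiceCoord₂ (a , b) = + 2 * (a + b)

twiceCoord₁ᴾ twiceCoord₂ᴾ : ∀ {k} → Weightᴾ k → Polynomial k
twiceCoord₁ᴾ (a , b) = con (+ 2) :* a :+ b
twiceCoord₂ᴾ (a , b) = con (+ 2) :* (a :+ b)

rootCombination : ℤ → ℤ → ℤ → ℤ → Weight
rootCombination x₁ x₂ x₃ x₄ =
  (x₁ · α₁) ⊕ ((x₂ · α₂) ⊕ ((x₃ · (α₁ ⊕ α₂)) ⊕ (x₄ · (α₁ ⊕ (α₂ ⊕ α₂)))))

rootCombinationᴾ : ∀ {k} → (x₁ x₂ x₃ x₄ : Polynomial k) → Weightᴾ k
rootCombinationᴾ x₁ x₂ x₃ x₄ =
  (x₁ ·ᴾ α₁ᴾ) ⊕ᴾ ((x₂ ·ᴾ α₂ᴾ) ⊕ᴾ ((x₃ ·ᴾ (α₁ᴾ ⊕ᴾ α₂ᴾ)) ⊕ᴾ (x₄ ·ᴾ (α₁ᴾ ⊕ᴾ (α₂ᴾ ⊕ᴾ α₂ᴾ)))))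

twiceCoord₁-rootCombination : ∀ x₁ x₂ x₃ x₄ →
  twiceCoord₁ (rootCombination x₁ x₂ x₃ x₄) ≡ + 2 * (x₁ + x₃ + x₄)
twiceCoord₁-rootCombination = solve 4 (λ x₁ x₂ x₃ x₄ →
  twiceCoord₁ᴾ (rootCombinationᴾ x₁ x₂ x₃ x₄) := con (+ 2) :* (x₁ :+ x₃ :+ x₄)) refl

twiceCoord₂-rootCombination : ∀ x₁ x₂ x₃ x₄ →
  twiceCoord₂ (rootCombination x₁ x₂ x₃ x₄) ≡ + 2 * (x₂ + x₃ + (x₄ + x₄))
twiceCoord₂-rootCombination = solve 4 (λ x₁ x₂ x₃ x₄ →
  twiceCoord₂ᴾ (rootCombinationᴾ x₁ x₂ x₃ x₄) := con (+ 2) :* (x₂ :+ x₃ :+ (x₄ :+ x₄))) refl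

nonempty : ∀ {A : Set} {ys : List A} → 0 ℕ.< length ys → ∃ (_∈ ys)
nonempty {ys = y ∷ _} _ = y , here refl

∈-concatMap-upTo : ∀ {A : Set} {f : ℕ → List A} {B k y} →
                   k ℕ.≤ B → y ∈ f k → y ∈ concatMap f (upTo (ℕ.suc B))
∈-concatMap-upTo {f = f} k≤B y∈fk = ∈-concatMap⁺ f (lose (∈-upTo⁺ (s≤s k≤B)) y∈fk)

∈-box : ∀ {B k₁ k₂ k₃ k₄} → k₁ ℕ.≤ B → k₂ ℕ.≤ B → k₃ ℕ.≤ B → k₄ ℕ.≤ B →
        (k₁ , k₂ , k₃ , k₄) ∈ box B
∈-box {B} k₁≤B k₂≤B k₃≤B k₄≤B =
  ∈-concatMap-upTo {f = row₁} k₁≤B (∈-concatMap-upTo {f = row₂ _} k₂≤B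
    (∈-concatMap-upTo {f = row₃ _ _} k₃≤B (∈-concatMap-upTo {f = row₄ _ _ _} k₄≤B (here refl))))
  where
  row₄ : ℕ → ℕ → ℕ → ℕ → List Quad
  row₄ k₁ k₂ k₃ k₄ = (k₁ , k₂ , k₃ , k₄) ∷ []
  row₃ : ℕ → ℕ → ℕ → List Quad
  row₃ k₁ k₂ k₃ = concatMap (row₄ k₁ k₂ k₃) (upTo (ℕ.suc B))
  row₂ : ℕ → ℕ → List Quad
  row₂ k₁ k₂ = concatMap (row₃ k₁ k₂) (upTo (ℕ.suc B))
  row₁ : ℕ → List Quad
  row₁ k₁ = concatMap (row₂ k₁) (upTo (ℕ.suc B))

IsCombo : Weight → Quad → Set
IsCombo ξ (k₁ , k₂ , k₃ , k₄) = combo k₁ k₂ k₃ k₄ ≡ ξ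

isCombo? : ∀ ξ → Decidable (IsCombo ξ)
isCombo? ξ (k₁ , k₂ , k₃ , k₄) = combo k₁ k₂ k₃ k₄ ≟w ξ

combo-twiceCoords-nonneg : ∀ k₁ k₂ k₃ k₄ →
  0ℤ ≤ twiceCoord₁ (combo k₁ k₂ k₃ k₄) × 0ℤ ≤ twiceCoord₂ (combo k₁ k₂ k₃ k₄)
combo-twiceCoords-nonneg k₁ k₂ k₃ k₄ =
  nonneg (k₁ ℕ.+ k₃ ℕ.+ k₄) (twiceCoord₁-rootCombination (+ k₁) (+ k₂) (+ k₃) (+ k₄)) ,
  nonneg (k₂ ℕ.+ k₃ ℕ.+ (k₄ ℕ.+ k₄)) (twiceCoord₂-rootCombination (+ k₁) (+ k₂) (+ k₃) (+ k₄))
  where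
  nonneg : ∀ {x} w → x ≡ + 2 * + w → 0ℤ ≤ x
  nonneg w x≡ = subst (0ℤ ≤_) (sym x≡) (0≤i⇒0≤2*i {+ w} (+≤+ z≤n))

℘-positive⇒ : ∀ ξ → 0 ℕ.< ℘ ξ → 0ℤ ≤ twiceCoord₁ ξ × 0ℤ ≤ twiceCoord₂ ξ
℘-positive⇒ ξ@(a , b) ℘>0
  with (k₁ , k₂ , k₃ , k₄) , k∈ ← nonempty {ys = filter (isCombo? ξ) (box (∣ a ∣ ℕ.+ ∣ b ∣))} ℘>0
  with _ , combo≡ξ ← ∈-filter⁻ (isCombo? ξ) {xs = box (∣ a ∣ ℕ.+ ∣ b ∣)} k∈ =
  subst (λ v → 0ℤ ≤ twiceCoord₁ v × 0ℤ ≤ twiceCoord₂ v) combo≡ξ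
        (combo-twiceCoords-nonneg k₁ k₂ k₃ k₄)

rootCombination-simple : ∀ a h → rootCombination (a + h) (a + h * + 2) 0ℤ 0ℤ ≡ (a , h * + 2)
rootCombination-simple a h = ×-≡,≡→≡ (coord₁ a h , coord₂ a h)
  where
  simpleᴾ : Polynomial 2 → Polynomial 2 → Weightᴾ 2
  simpleᴾ a h = rootCombinationᴾ (a :+ h) (a :+ h :* con (+ 2)) (con 0ℤ) (con 0ℤ)
  coord₁ : ∀ a h → proj₁ (rootCombination (a + h) (a + h * + 2) 0ℤ 0ℤ) ≡ a
  coord₁ = solve 2 (λ a h → proj₁ (simpleᴾ a h) := a) refl
  coord₂ : ∀ a h → proj₂ (rootCombination (a + h) (a + h * + 2) 0ℤ 0ℤ) ≡ h * + 2
  coord₂ = solve 2 (λ a h → proj₂ (simpleᴾ a h) := h :* con (+ 2)) refl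

℘-positive⇐ : ∀ a h → 0ℤ ≤ twiceCoord₁ (a , h * + 2) → 0ℤ ≤ twiceCoord₂ (a , h * + 2) →
              0 ℕ.< ℘ (a , h * + 2)
℘-positive⇐ a h 0≤X 0≤Y =
  ∈-length (∈-filter⁺ (isCombo? (a , h * + 2)) (∈-box bound₁ bound₂ z≤n z≤n) hit)
  where
  double : ∀ a h → + 2 * a + h * + 2 ≡ + 2 * (a + h)
  double = solve-∀
  0≤x : 0ℤ ≤ a + h
  0≤x = 0≤2*i⇒0≤i (subst (0ℤ ≤_) (double a h) 0≤X)
  0≤y : 0ℤ ≤ a + h * + 2
  0≤y = 0≤2*i⇒0≤i 0≤Y
  hit : combo ∣ a + h ∣ ∣ a + h * + 2 ∣ 0 0 ≡ (a , h * + 2)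
  hit = trans (cong₂ (λ x y → rootCombination x y 0ℤ 0ℤ) (ℤ.0≤i⇒+∣i∣≡i 0≤x) (ℤ.0≤i⇒+∣i∣≡i 0≤y))
              (rootCombination-simple a h)
  bound₁ : ∣ a + h ∣ ℕ.≤ ∣ a ∣ ℕ.+ ∣ h * + 2 ∣
  bound₁ = ℕ.≤-trans (ℤ.∣i+j∣≤∣i∣+∣j∣ a h)
             (ℕ.+-monoʳ-≤ ∣ a ∣ (subst (∣ h ∣ ℕ.≤_) (sym (ℤ.abs-* h (+ 2))) (ℕ.m≤m*n ∣ h ∣ 2)))
  bound₂ : ∣ a + h * + 2 ∣ ℕ.≤ ∣ a ∣ ℕ.+ ∣ h * + 2 ∣
  bound₂ = ℤ.∣i+j∣≤∣i∣+∣j∣ a (h * + 2)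

℘-positive⇔ : ∀ ξ → + 2 ∣ proj₂ ξ → 0 ℕ.< ℘ ξ ⇔ (0ℤ ≤ twiceCoord₁ ξ × 0ℤ ≤ twiceCoord₂ ξ)
℘-positive⇔ ξ@(a , _) (divides h refl) =
  mk⇔ (℘-positive⇒ ξ) (λ (0≤X , 0≤Y) → ℘-positive⇐ a h 0≤X 0≤Y)

-- The alternation set through the inequalities J

shifted : W → Weight → Weight → Weight
shifted σ λ′ μ = act σ (λ′ ⊕ ρ) ⊖ (μ ⊕ ρ)

shiftedᴾ : ∀ {k} → W → Weightᴾ k → Weightᴾ k → Weightᴾ k
shiftedᴾ σ λ′ μ = actᴾ σ (λ′ ⊕ᴾ ρᴾ) ⊖ᴾ (μ ⊕ᴾ ρᴾ)

shifted-even : ∀ σ {λ′ μ} → λ′ ∼ μ → + 2 ∣ proj₂ (shifted σ λ′ μ)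
shifted-even σ {λ′} λ′∼μ = _∼_.even (∼-trans (act-∼ σ (λ′ ⊕ ρ)) (⊕ρ-∼ λ′∼μ))

α₁-ineq α₂-ineq : W → Idx
α₁-ineq e = j1
α₁-ineq s₁ = j3
α₁-ineq s₂ = j1
α₁-ineq s₂s₁ = j3
α₁-ineq s₁s₂ = j6
α₁-ineq s₁s₂s₁ = j7
α₁-ineq s₂s₁s₂ = j6
α₁-ineq s₂s₁s₂s₁ = j7
α₂-ineq e = j2
α₂-ineq s₁ = j2
α₂-ineq s₂ = j4
α₂-ineq s₂s₁ = j5
α₂-ineq s₁s₂ = j4
α₂-ineq s₁s₂s₁ = j5
α₂-ineq s₂s₁s₂ = j8
α₂-ineq s₂s₁s₂s₁ = j8

α₁-ineq-identityᴾ α₂-ineq-identityᴾ : W → (c₁ c₂ n m : Polynomial 4) → Polynomial 4 × Polynomial 4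
α₁-ineq-identityᴾ σ c₁ c₂ n m =
  twoJᴾ (α₁-ineq σ) c₁ c₂ n m := twiceCoord₁ᴾ (shiftedᴾ σ (c₁ , c₂) (n , m))
α₂-ineq-identityᴾ σ c₁ c₂ n m =
  twoJᴾ (α₂-ineq σ) c₁ c₂ n m := twiceCoord₂ᴾ (shiftedᴾ σ (c₁ , c₂) (n , m))

twoJ-α₁-ineq : ∀ σ c₁ c₂ n m →
  twoJ (α₁-ineq σ) c₁ c₂ n m ≡ twiceCoord₁ (shifted σ (wt c₁ c₂) (wt n m))
twoJ-α₁-ineq e = solve 4 (α₁-ineq-identityᴾ e) refl
twoJ-α₁-ineq s₁ = solve 4 (α₁-ineq-identityᴾ s₁) refl
twoJ-α₁-ineq s₂ = solve 4 (α₁-ineq-identityᴾ s₂) refl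
twoJ-α₁-ineq s₂s₁ = solve 4 (α₁-ineq-identityᴾ s₂s₁) refl
twoJ-α₁-ineq s₁s₂ = solve 4 (α₁-ineq-identityᴾ s₁s₂) refl
twoJ-α₁-ineq s₁s₂s₁ = solve 4 (α₁-ineq-identityᴾ s₁s₂s₁) refl
twoJ-α₁-ineq s₂s₁s₂ = solve 4 (α₁-ineq-identityᴾ s₂s₁s₂) refl
twoJ-α₁-ineq s₂s₁s₂s₁ = solve 4 (α₁-ineq-identityᴾ s₂s₁s₂s₁) refl

twoJ-α₂-ineq : ∀ σ c₁ c₂ n m →
  twoJ (α₂-ineq σ) c₁ c₂ n m ≡ twiceCoord₂ (shifted σ (wt c₁ c₂) (wt n m))
twoJ-α₂-ineq e = solve 4 (α₂-ineq-identityᴾ e) refl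
twoJ-α₂-ineq s₁ = solve 4 (α₂-ineq-identityᴾ s₁) refl
twoJ-α₂-ineq s₂ = solve 4 (α₂-ineq-identityᴾ s₂) refl
twoJ-α₂-ineq s₂s₁ = solve 4 (α₂-ineq-identityᴾ s₂s₁) refl
twoJ-α₂-ineq s₁s₂ = solve 4 (α₂-ineq-identityᴾ s₁s₂) refl
twoJ-α₂-ineq s₁s₂s₁ = solve 4 (α₂-ineq-identityᴾ s₁s₂s₁) refl
twoJ-α₂-ineq s₂s₁s₂ = solve 4 (α₂-ineq-identityᴾ s₂s₁s₂) refl
twoJ-α₂-ineq s₂s₁s₂s₁ = solve 4 (α₂-ineq-identityᴾ s₂s₁s₂s₁) refl

InA⇔J : ∀ {c₁ c₂ n m} → wt c₁ c₂ ∼ wt n m → ∀ σ →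
        InA (wt c₁ c₂) (wt n m) σ ⇔ (J (α₁-ineq σ) c₁ c₂ n m × J (α₂-ineq σ) c₁ c₂ n m)
InA⇔J {c₁} {c₂} {n} {m} λ∼μ σ rewrite twoJ-α₁-ineq σ c₁ c₂ n m | twoJ-α₂-ineq σ c₁ c₂ n m =
  ℘-positive⇔ (shifted σ (wt c₁ c₂) (wt n m)) (shifted-even σ λ∼μ)

-- Linear relations among the J's

data Rule : Set where
  excludes : Idx → Idx → Rule
  forces : Idx → Idx → Idx → Rule

Obeys : (Idx → Set) → Rule → Set
Obeys P (excludes a b) = P a → P b → ⊥
Obeys P (forces a b c) = P a → P b → P c

rules : List Rule
rules =
    excludes j1 j7 ∷ excludes j2 j8 ∷ excludes j3 j6 ∷ excludes j4 j5
  ∷ forces j1 j3 j2 ∷ forces j2 j4 j1 ∷ forces j3 j7 j5 ∷ forces j4 j8 j6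
  ∷ forces j5 j8 j7 ∷ forces j6 j7 j8 ∷ forces j1 j6 j4 ∷ forces j2 j5 j3
  ∷ forces j1 j5 j3 ∷ forces j2 j6 j4 ∷ forces j3 j4 j1 ∷ forces j1 j8 j4
  ∷ forces j2 j7 j3 ∷ forces j3 j8 j5 ∷ forces j4 j7 j6 ∷ forces j5 j6 j7
  ∷ []

tᴾ : Idx → Polynomial 4
tᴾ i = twoJᴾ i (var zero) (var (suc zero)) (var (suc (suc zero))) (var (suc (suc (suc zero))))

J₁+J₇-negative : ∀ c₁ c₂ n m →
  twoJ j1 c₁ c₂ n m + twoJ j7 c₁ c₂ n m + (n + n + n + n + m + m) ≡ - + 6
J₁+J₇-negative = solve 4 (λ _ _ n m →
  tᴾ j1 :+ tᴾ j7 :+ (n :+ n :+ n :+ n :+ m :+ m) := con (- + 6)) refl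

J₂+J₈-negative : ∀ c₁ c₂ n m →
  twoJ j2 c₁ c₂ n m + twoJ j8 c₁ c₂ n m + (n + n + n + n + m + m + m + m) ≡ - + 8
J₂+J₈-negative = solve 4 (λ _ _ n m →
  tᴾ j2 :+ tᴾ j8 :+ (n :+ n :+ n :+ n :+ m :+ m :+ m :+ m) := con (- + 8)) refl

J₃+J₆-negative : ∀ c₁ c₂ n m →
  twoJ j3 c₁ c₂ n m + twoJ j6 c₁ c₂ n m + (n + n + n + n + m + m) ≡ - + 6
J₃+J₆-negative = solve 4 (λ _ _ n m →
  tᴾ j3 :+ tᴾ j6 :+ (n :+ n :+ n :+ n :+ m :+ m) := con (- + 6)) refl

J₄+J₅-negative : ∀ c₁ c₂ n m →
  twoJ j4 c₁ c₂ n m + twoJ j5 c₁ c₂ n m + (n + n + n + n + m + m + m + m) ≡ - + 8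
J₄+J₅-negative = solve 4 (λ _ _ n m →
  tᴾ j4 :+ tᴾ j5 :+ (n :+ n :+ n :+ n :+ m :+ m :+ m :+ m) := con (- + 8)) refl

J₂-via-J₁J₃ : ∀ c₁ c₂ n m →
  twoJ j2 c₁ c₂ n m ≡ twoJ j1 c₁ c₂ n m + twoJ j3 c₁ c₂ n m + (n + n + + 2)
J₂-via-J₁J₃ = solve 4 (λ _ _ n _ →
  tᴾ j2 := tᴾ j1 :+ tᴾ j3 :+ (n :+ n :+ con (+ 2))) refl

J₁-via-J₂J₄ : ∀ c₁ c₂ n m →
  + 2 * twoJ j1 c₁ c₂ n m ≡ twoJ j2 c₁ c₂ n m + twoJ j4 c₁ c₂ n m + (m + m + + 2)
J₁-via-J₂J₄ = solve 4 (λ _ _ _ m →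
  con (+ 2) :* tᴾ j1 := tᴾ j2 :+ tᴾ j4 :+ (m :+ m :+ con (+ 2))) refl

J₅-via-J₃J₇ : ∀ c₁ c₂ n m →
  twoJ j5 c₁ c₂ n m ≡ twoJ j3 c₁ c₂ n m + twoJ j7 c₁ c₂ n m + (n + n + + 2)
J₅-via-J₃J₇ = solve 4 (λ _ _ n _ →
  tᴾ j5 := tᴾ j3 :+ tᴾ j7 :+ (n :+ n :+ con (+ 2))) refl

J₆-via-J₄J₈ : ∀ c₁ c₂ n m →
  + 2 * twoJ j6 c₁ c₂ n m ≡ twoJ j4 c₁ c₂ n m + twoJ j8 c₁ c₂ n m + (m + m + + 2)
J₆-via-J₄J₈ = solve 4 (λ _ _ _ m →
  con (+ 2) :* tᴾ j6 := tᴾ j4 :+ tᴾ j8 :+ (m :+ m :+ con (+ 2))) refl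

J₇-via-J₅J₈ : ∀ c₁ c₂ n m →
  + 2 * twoJ j7 c₁ c₂ n m ≡ twoJ j5 c₁ c₂ n m + twoJ j8 c₁ c₂ n m + (m + m + + 2)
J₇-via-J₅J₈ = solve 4 (λ _ _ _ m →
  con (+ 2) :* tᴾ j7 := tᴾ j5 :+ tᴾ j8 :+ (m :+ m :+ con (+ 2))) refl

J₈-via-J₆J₇ : ∀ c₁ c₂ n m →
  twoJ j8 c₁ c₂ n m ≡ twoJ j6 c₁ c₂ n m + twoJ j7 c₁ c₂ n m + (n + n + + 2)
J₈-via-J₆J₇ = solve 4 (λ _ _ n _ →
  tᴾ j8 := tᴾ j6 :+ tᴾ j7 :+ (n :+ n :+ con (+ 2))) refl

J₄-via-J₁J₆ : ∀ c₁ c₂ n m →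
  twoJ j4 c₁ c₂ n m ≡ twoJ j1 c₁ c₂ n m + twoJ j6 c₁ c₂ n m + (n + n + + 2)
J₄-via-J₁J₆ = solve 4 (λ _ _ n _ →
  tᴾ j4 := tᴾ j1 :+ tᴾ j6 :+ (n :+ n :+ con (+ 2))) refl

J₃-via-J₂J₅ : ∀ c₁ c₂ n m →
  + 2 * twoJ j3 c₁ c₂ n m ≡ twoJ j2 c₁ c₂ n m + twoJ j5 c₁ c₂ n m + (m + m + + 2)
J₃-via-J₂J₅ = solve 4 (λ _ _ _ m →
  con (+ 2) :* tᴾ j3 := tᴾ j2 :+ tᴾ j5 :+ (m :+ m :+ con (+ 2))) refl

J₃-via-J₁J₅ : ∀ c₁ c₂ n m →
  twoJ j3 c₁ c₂ n m ≡ twoJ j1 c₁ c₂ n m + twoJ j5 c₁ c₂ n m + (n + n + m + m + + 4)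
J₃-via-J₁J₅ = solve 4 (λ _ _ n m →
  tᴾ j3 := tᴾ j1 :+ tᴾ j5 :+ (n :+ n :+ m :+ m :+ con (+ 4))) refl

J₄-via-J₂J₆ : ∀ c₁ c₂ n m →
  twoJ j4 c₁ c₂ n m ≡ twoJ j2 c₁ c₂ n m + + 2 * twoJ j6 c₁ c₂ n m + (n + n + n + n + m + m + + 6)
J₄-via-J₂J₆ = solve 4 (λ _ _ n m →
  tᴾ j4 := tᴾ j2 :+ con (+ 2) :* tᴾ j6 :+ (n :+ n :+ n :+ n :+ m :+ m :+ con (+ 6))) refl

J₁-via-J₃J₄ : ∀ c₁ c₂ n m →
  twoJ j1 c₁ c₂ n m ≡ twoJ j3 c₁ c₂ n m + twoJ j4 c₁ c₂ n m + (n + n + m + m + + 4)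
J₁-via-J₃J₄ = solve 4 (λ _ _ n m →
  tᴾ j1 := tᴾ j3 :+ tᴾ j4 :+ (n :+ n :+ m :+ m :+ con (+ 4))) refl

J₄-via-J₁J₈ : ∀ c₁ c₂ n m →
  twoJ j4 c₁ c₂ n m ≡ + 2 * twoJ j1 c₁ c₂ n m + twoJ j8 c₁ c₂ n m + (n + n + n + n + m + m + + 6)
J₄-via-J₁J₈ = solve 4 (λ _ _ n m →
  tᴾ j4 := con (+ 2) :* tᴾ j1 :+ tᴾ j8 :+ (n :+ n :+ n :+ n :+ m :+ m :+ con (+ 6))) refl

J₃-via-J₂J₇ : ∀ c₁ c₂ n m →
  twoJ j3 c₁ c₂ n m ≡ twoJ j2 c₁ c₂ n m + twoJ j7 c₁ c₂ n m + (n + n + m + m + + 4)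
J₃-via-J₂J₇ = solve 4 (λ _ _ n m →
  tᴾ j3 := tᴾ j2 :+ tᴾ j7 :+ (n :+ n :+ m :+ m :+ con (+ 4))) refl

J₅-via-J₃J₈ : ∀ c₁ c₂ n m →
  twoJ j5 c₁ c₂ n m ≡ + 2 * twoJ j3 c₁ c₂ n m + twoJ j8 c₁ c₂ n m + (n + n + n + n + m + m + + 6)
J₅-via-J₃J₈ = solve 4 (λ _ _ n m →
  tᴾ j5 := con (+ 2) :* tᴾ j3 :+ tᴾ j8 :+ (n :+ n :+ n :+ n :+ m :+ m :+ con (+ 6))) refl

J₆-via-J₄J₇ : ∀ c₁ c₂ n m →
  twoJ j6 c₁ c₂ n m ≡ twoJ j4 c₁ c₂ n m + twoJ j7 c₁ c₂ n m + (n + n + m + m + + 4)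
J₆-via-J₄J₇ = solve 4 (λ _ _ n m →
  tᴾ j6 := tᴾ j4 :+ tᴾ j7 :+ (n :+ n :+ m :+ m :+ con (+ 4))) refl

J₇-via-J₅J₆ : ∀ c₁ c₂ n m →
  twoJ j7 c₁ c₂ n m ≡ twoJ j5 c₁ c₂ n m + twoJ j6 c₁ c₂ n m + (n + n + m + m + + 4)
J₇-via-J₅J₆ = solve 4 (λ _ _ n m →
  tᴾ j7 := tᴾ j5 :+ tᴾ j6 :+ (n :+ n :+ m :+ m :+ con (+ 4))) refl

rules-obeyed : ∀ c₁ c₂ n m → All (Obeys (λ i → J i c₁ c₂ (+ n) (+ m))) rules
rules-obeyed c₁ c₂ n m =
    negative-sum-excludes (at J₁+J₇-negative) ∷ negative-sum-excludes (at J₂+J₈-negative)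
  ∷ negative-sum-excludes (at J₃+J₆-negative) ∷ negative-sum-excludes (at J₄+J₅-negative)
  ∷ 0≤-sum (at J₂-via-J₁J₃)
  ∷ (λ J₂ J₄ → 0≤2*i⇒0≤i (0≤-sum (at J₁-via-J₂J₄) J₂ J₄))
  ∷ 0≤-sum (at J₅-via-J₃J₇)
  ∷ (λ J₄ J₈ → 0≤2*i⇒0≤i (0≤-sum (at J₆-via-J₄J₈) J₄ J₈))
  ∷ (λ J₅ J₈ → 0≤2*i⇒0≤i (0≤-sum (at J₇-via-J₅J₈) J₅ J₈))
  ∷ 0≤-sum (at J₈-via-J₆J₇)
  ∷ 0≤-sum (at J₄-via-J₁J₆)
  ∷ (λ J₂ J₅ → 0≤2*i⇒0≤i (0≤-sum (at J₃-via-J₂J₅) J₂ J₅))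
  ∷ 0≤-sum (at J₃-via-J₁J₅)
  ∷ (λ J₂ J₆ → 0≤-sum (at J₄-via-J₂J₆) J₂ (0≤i⇒0≤2*i J₆))
  ∷ 0≤-sum (at J₁-via-J₃J₄)
  ∷ (λ J₁ J₈ → 0≤-sum (at J₄-via-J₁J₈) (0≤i⇒0≤2*i J₁) J₈)
  ∷ 0≤-sum (at J₃-via-J₂J₇)
  ∷ (λ J₃ J₈ → 0≤-sum (at J₅-via-J₃J₈) (0≤i⇒0≤2*i J₃) J₈)
  ∷ 0≤-sum (at J₆-via-J₄J₇)
  ∷ 0≤-sum (at J₇-via-J₅J₆)
  ∷ []
  where
  at : {P : ℤ → ℤ → ℤ → ℤ → Set} → (∀ c₁ c₂ n m → P c₁ c₂ n m) → P c₁ c₂ (+ n) (+ m)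
  at identity = identity c₁ c₂ (+ n) (+ m)

-- Exhaustive check of the truth patterns of J₁, …, J₈

elementsW : List W
elementsW = e ∷ s₁ ∷ s₂ ∷ s₂s₁ ∷ s₁s₂ ∷ s₁s₂s₁ ∷ s₂s₁s₂ ∷ s₂s₁s₂s₁ ∷ []

position : W → Fin 8
position e = zero
position s₁ = suc zero
position s₂ = suc (suc zero)
position s₂s₁ = suc (suc (suc zero))
position s₁s₂ = suc (suc (suc (suc zero)))
position s₁s₂s₁ = suc (suc (suc (suc (suc zero))))
position s₂s₁s₂ = suc (suc (suc (suc (suc (suc zero)))))
position s₂s₁s₂s₁ = suc (suc (suc (suc (suc (suc (suc zero))))))

lookup-position : ∀ σ → lookup elementsW (position σ) ≡ σ
lookup-position e = refl
lookup-position s₁ = refl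
lookup-position s₂ = refl
lookup-position s₂s₁ = refl
lookup-position s₁s₂ = refl
lookup-position s₁s₂s₁ = refl
lookup-position s₂s₁s₂ = refl
lookup-position s₂s₁s₂s₁ = refl

∈-elementsW : ∀ σ → σ ∈ elementsW
∈-elementsW σ = subst (_∈ elementsW) (lookup-position σ) (∈-lookup (position σ))

_≟W_ : DecidableEquality W
σ ≟W τ = map′ position-injective (cong position) (position σ Fin.≟ position τ)
  where
  position-injective : position σ ≡ position τ → σ ≡ τ
  position-injective eq =
    trans (sym (lookup-position σ)) (trans (cong (lookup elementsW) eq) (lookup-position τ))

Profile : Set
Profile = Vec Bool 8

_‼_ : Profile → Idx → Bool
v ‼ j1 = Vec.lookup v zero
v ‼ j2 = Vec.lookup v (suc zero)
v ‼ j3 = Vec.lookup v (suc (suc zero))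
v ‼ j4 = Vec.lookup v (suc (suc (suc zero)))
v ‼ j5 = Vec.lookup v (suc (suc (suc (suc zero))))
v ‼ j6 = Vec.lookup v (suc (suc (suc (suc (suc zero)))))
v ‼ j7 = Vec.lookup v (suc (suc (suc (suc (suc (suc zero))))))
v ‼ j8 = Vec.lookup v (suc (suc (suc (suc (suc (suc (suc zero)))))))

tabulateIdx : (Idx → Bool) → Profile
tabulateIdx f = f j1 ∷ f j2 ∷ f j3 ∷ f j4 ∷ f j5 ∷ f j6 ∷ f j7 ∷ f j8 ∷ []

‼-tabulateIdx : ∀ f i → tabulateIdx f ‼ i ≡ f i
‼-tabulateIdx f j1 = refl
‼-tabulateIdx f j2 = refl
‼-tabulateIdx f j3 = refl
‼-tabulateIdx f j4 = refl
‼-tabulateIdx f j5 = refl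
‼-tabulateIdx f j6 = refl
‼-tabulateIdx f j7 = refl
‼-tabulateIdx f j8 = refl

allVec : ∀ n → (Vec Bool n → Bool) → Bool
allVec ℕ.zero p = p []
allVec (ℕ.suc n) p = allVec n (p ∘ (true ∷_)) ∧ allVec n (p ∘ (false ∷_))

allVec-sound : ∀ n p → T (allVec n p) → ∀ v → T (p v)
allVec-sound ℕ.zero p holds [] = holds
allVec-sound (ℕ.suc n) p holds (true ∷ v) = allVec-sound n _ (proj₁ (Equivalence.to T-∧ holds)) v
allVec-sound (ℕ.suc n) p holds (false ∷ v) =
  allVec-sound n _ (proj₂ (Equivalence.to (T-∧ {allVec n (p ∘ (true ∷_))}) holds)) v

modus-ponensᵇ : ∀ {x y} → T (not x ∨ y) → T x → T y
modus-ponensᵇ {true} y _ = y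

obeysᵇ : Profile → Rule → Bool
obeysᵇ v (excludes a b) = not (v ‼ a ∧ v ‼ b)
obeysᵇ v (forces a b c) = not (v ‼ a ∧ v ‼ b) ∨ v ‼ c

Obeys-map : ∀ {P Q : Idx → Set} → (∀ i → P i ⇔ Q i) → ∀ r → Obeys P r → Obeys Q r
Obeys-map P⇔Q (excludes a b) obeys qa qb =
  obeys (Equivalence.from (P⇔Q a) qa) (Equivalence.from (P⇔Q b) qb)
Obeys-map P⇔Q (forces a b c) obeys qa qb =
  Equivalence.to (P⇔Q c) (obeys (Equivalence.from (P⇔Q a) qa) (Equivalence.from (P⇔Q b) qb))

obeysᵇ-complete : ∀ v r → Obeys (λ i → T (v ‼ i)) r → T (obeysᵇ v r)
obeysᵇ-complete v (excludes a b) = nand (v ‼ a) (v ‼ b)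
  where
  nand : ∀ x y → (T x → T y → ⊥) → T (not (x ∧ y))
  nand true true excl = excl _ _
  nand true false _ = _
  nand false _ _ = _
obeysᵇ-complete v (forces a b c) = implies (v ‼ a) (v ‼ b) (v ‼ c)
  where
  implies : ∀ x y z → (T x → T y → T z) → T (not (x ∧ y) ∨ z)
  implies true true _ force = force _ _
  implies true false _ _ = _
  implies false _ _ _ = _

consistentᵇ : Profile → Bool
consistentᵇ v = all (obeysᵇ v) rules

holdsᵇ : Profile → Case → Bool
holdsᵇ v (case p q r s _) = v ‼ p ∧ (v ‼ q ∧ (not (v ‼ r) ∧ not (v ‼ s)))

alternationᵇ : Profile → List W
alternationᵇ v = filterᵇ (λ σ → v ‼ α₁-ineq σ ∧ v ‼ α₂-ineq σ) elementsW

determinedᵇ : Profile → Case → Bool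
determinedᵇ v C = not (holdsᵇ v C) ∨ ⌊ ≡-dec _≟W_ (alternationᵇ v) (Case.set C) ⌋

tableCorrectᵇ : Profile → Bool
tableCorrectᵇ v =
  all (determinedᵇ v) cases ∧ (any (holdsᵇ v) cases ∨ ⌊ ≡-dec _≟W_ (alternationᵇ v) [] ⌋)

record TableCorrect (v : Profile) : Set where
  field
    determined : ∀ {C} → C ∈ cases → T (holdsᵇ v C) → alternationᵇ v ≡ Case.set C
    empty : (∀ {C} → C ∈ cases → ¬ T (holdsᵇ v C)) → alternationᵇ v ≡ []

tableCorrectᵇ-sound : ∀ v → T (tableCorrectᵇ v) → TableCorrect v
tableCorrectᵇ-sound v correct = record { determined = determined ; empty = empty }
  where
  casesCorrect : T (all (determinedᵇ v) cases) ×
                 T (any (holdsᵇ v) cases ∨ ⌊ ≡-dec _≟W_ (alternationᵇ v) [] ⌋)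
  casesCorrect = Equivalence.to T-∧ correct
  determined : ∀ {C} → C ∈ cases → T (holdsᵇ v C) → alternationᵇ v ≡ Case.set C
  determined C∈ =
    toWitness ∘ modus-ponensᵇ (All.lookup (all⁺ (determinedᵇ v) cases (proj₁ casesCorrect)) C∈)
  empty : (∀ {C} → C ∈ cases → ¬ T (holdsᵇ v C)) → alternationᵇ v ≡ []
  empty none with Equivalence.to T-∨ (proj₂ casesCorrect)
  ... | inj₁ some = let _ , C∈ , holds = find (any⁻ (holdsᵇ v) cases some) in ⊥-elim (none C∈ holds)
  ... | inj₂ isEmpty = toWitness isEmpty

consistent⇒TableCorrect : ∀ v → T (consistentᵇ v) → TableCorrect v
consistent⇒TableCorrect v =
  tableCorrectᵇ-sound v ∘
  modus-ponensᵇ (allVec-sound 8 (λ v → not (consistentᵇ v) ∨ tableCorrectᵇ v) _ v)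

J? : ∀ i c₁ c₂ n m → Dec (J i c₁ c₂ n m)
J? i c₁ c₂ n m = 0ℤ ℤ.≤? twoJ i c₁ c₂ n m

profile : ℤ → ℤ → ℤ → ℤ → Profile
profile c₁ c₂ n m = tabulateIdx (λ i → isYes (J? i c₁ c₂ n m))

profile⇔J : ∀ {c₁ c₂ n m} i → T (profile c₁ c₂ n m ‼ i) ⇔ J i c₁ c₂ n m
profile⇔J {c₁} {c₂} {n} {m} i rewrite ‼-tabulateIdx (λ i → isYes (J? i c₁ c₂ n m)) i =
  mk⇔ toWitness fromWitness

profile⇔¬J : ∀ {c₁ c₂ n m} i → T (not (profile c₁ c₂ n m ‼ i)) ⇔ (¬ J i c₁ c₂ n m)
profile⇔¬J {c₁} {c₂} {n} {m} i rewrite ‼-tabulateIdx (λ i → isYes (J? i c₁ c₂ n m)) i =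
  mk⇔ toWitnessFalse fromWitnessFalse

profile-consistent : ∀ c₁ c₂ n m → T (consistentᵇ (profile c₁ c₂ (+ n) (+ m)))
profile-consistent c₁ c₂ n m =
  all⁻ (obeysᵇ v) (All.map (λ {r} → obeysᵇ-complete v r ∘ Obeys-map (⇔.sym ∘ profile⇔J) r)
                            (rules-obeyed c₁ c₂ n m))
  where v = profile c₁ c₂ (+ n) (+ m)

Holds⇔holdsᵇ : ∀ {c₁ c₂ n m} C → Holds C c₁ c₂ n m ⇔ T (holdsᵇ (profile c₁ c₂ n m) C)
Holds⇔holdsᵇ (case p q r s _) =
  ⇔.sym (⇔.trans (⇔.trans T-∧ (⇔.refl ×-⇔ ⇔.trans T-∧ (⇔.refl ×-⇔ T-∧)))
                 (profile⇔J p ×-⇔ profile⇔J q ×-⇔ profile⇔¬J r ×-⇔ profile⇔¬J s))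

∈-alternationᵇ⇔ : ∀ v σ → σ ∈ alternationᵇ v ⇔ T (v ‼ α₁-ineq σ ∧ v ‼ α₂-ineq σ)
∈-alternationᵇ⇔ v σ =
  mk⇔ (proj₂ ∘ ∈-filter⁻ (T? ∘ inA) {xs = elementsW}) (∈-filter⁺ (T? ∘ inA) (∈-elementsW σ))
  where inA = λ σ → v ‼ α₁-ineq σ ∧ v ‼ α₂-ineq σ

InA⇔∈alternationᵇ : ∀ {c₁ c₂ n m} → wt c₁ c₂ ∼ wt n m → ∀ σ →
                    InA (wt c₁ c₂) (wt n m) σ ⇔ σ ∈ alternationᵇ (profile c₁ c₂ n m)
InA⇔∈alternationᵇ {c₁} {c₂} {n} {m} λ∼μ σ =
  ⇔.trans (InA⇔J λ∼μ σ)
    (⇔.sym (⇔.trans (∈-alternationᵇ⇔ (profile c₁ c₂ n m) σ)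
                    (⇔.trans T-∧ (profile⇔J (α₁-ineq σ) ×-⇔ profile⇔J (α₂-ineq σ)))))

theorem3p2 : (c₁ c₂ : ℤ) (n m : ℕ) → + 2 ℤ.∣ c₂ → + 2 ℤ.∣ + m →
    ((C : Case) → C ∈ cases → Holds C c₁ c₂ (+ n) (+ m) →
      (σ : W) → InA (wt c₁ c₂) (wt (+ n) (+ m)) σ ⇔ σ ∈ Case.set C)
    × (((C : Case) → C ∈ cases → ¬ Holds C c₁ c₂ (+ n) (+ m)) →
      (σ : W) → ¬ InA (wt c₁ c₂) (wt (+ n) (+ m)) σ)
theorem3p2 c₁ c₂ n m 2∣c₂ 2∣m = ifCaseHolds , ifNoCaseHolds
  where
  λ∼μ : wt c₁ c₂ ∼ wt (+ n) (+ m)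
  λ∼μ = evenDifference (∣m∣n⇒∣m-n (∣ᵤ⇒∣ {i = c₂} 2∣c₂) (∣ᵤ⇒∣ {i = + m} 2∣m))
  table : TableCorrect (profile c₁ c₂ (+ n) (+ m))
  table = consistent⇒TableCorrect (profile c₁ c₂ (+ n) (+ m)) (profile-consistent c₁ c₂ n m)
  InA⇔∈ : ∀ σ → InA (wt c₁ c₂) (wt (+ n) (+ m)) σ ⇔ σ ∈ alternationᵇ (profile c₁ c₂ (+ n) (+ m))
  InA⇔∈ = InA⇔∈alternationᵇ λ∼μ
  ifCaseHolds : (C : Case) → C ∈ cases → Holds C c₁ c₂ (+ n) (+ m) →
               (σ : W) → InA (wt c₁ c₂) (wt (+ n) (+ m)) σ ⇔ σ ∈ Case.set C
  ifCaseHolds C C∈ holds σ = subst (λ S → InA (wt c₁ c₂) (wt (+ n) (+ m)) σ ⇔ σ ∈ S)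
    (TableCorrect.determined table C∈ (Equivalence.to (Holds⇔holdsᵇ C) holds)) (InA⇔∈ σ)
  ifNoCaseHolds : ((C : Case) → C ∈ cases → ¬ Holds C c₁ c₂ (+ n) (+ m)) →
          (σ : W) → ¬ InA (wt c₁ c₂) (wt (+ n) (+ m)) σ
  ifNoCaseHolds none σ = ¬Any[] ∘ subst (σ ∈_) noAlternation ∘ Equivalence.to (InA⇔∈ σ)
    where
    noAlternation : alternationᵇ (profile c₁ c₂ (+ n) (+ m)) ≡ []
    noAlternation =
      TableCorrect.empty table (λ {C} C∈ → none C C∈ ∘ Equivalence.from (Holds⇔holdsᵇ C))
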